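{- Let $\Gamma$ be a finite, connected, simple, undirected graph with at least one edge and vertex set $V_\Gamma=\{v_1,\dots,v_n\}$, let $G$ be a group, let $s\in Z(G)$ with $s^2=1_G$, and let $\psi_1,\psi_2$ be $G$-gain functions on $\Gamma$. The following are equivalent: (1) $\psi_1$ and $\psi_2$ are switching equivalent; (2) $A_{\Gamma,\psi_1}\sim A_{\Gamma,\psi_2}$; (3) $\Delta^{s}_{\Gamma,\psi_1}\sim \Delta^{s}_{\Gamma,\psi_2}$.
   Context: $\mathbb CG$ is the complex group algebra of $G$ (finite formal sums $\sum_{x\in G} f_x x$, $f_x\in\mathbb C$), with multiplication extending that of $G$ and involution $(\sum f_x x)^*=\sum \overline{f_x}\,x^{ -1}$; $G$ is regarded as a subset of $\mathbb CG$ and $0$ denotes the zero of $\mathbb CG$. $M_n(\mathbb CG)$ is the algebra of $n\times n$ matrices over $\mathbb CG$ with the usual matrix product and $(A^*)_{i,j}=(A_{j,i})^*$. A $G$-gain function on $\Gamma$ is a map $\psi$ from the set of ordered pairs $(u,v)$ of adjacent vertices to $G$ with $\psi(v,u)=\psi(u,v)^{ -1}$. Two gain functions $\psi_1,\psi_2$ are switching equivalent if there is $f\colon V_\Gamma\to G$ with $\psi_2(v_i,v_j)=f(v_i)^{ -1}\psi_1(v_i,v_j)f(v_j)$ for all adjacent $v_i,v_j$. The adjacency matrix $A_{\Gamma,\psi}\in M_n(\mathbb CG)$ has $(i,j)$ entry $\psi(v_i,v_j)$ if $v_i\sim v_j$ and $0$ otherwise. The $s$-Laplacian is $\Delta^s_{\Gamma,\psi}=\deg(\Gamma,G)+sA_{\Gamma,\psi}$,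 where $\deg(\Gamma,G)=\mathrm{diag}(\deg(v_1)1_G,\dots,\deg(v_n)1_G)$ and $sA$ means multiplying each entry on the left by $s$. For $A,B\in M_n(\mathbb CG)$, $A\sim B$ means there is a diagonal $F\in M_n(\mathbb CG)$ with all diagonal entries in $G$ such that $F^*AF=B$. -}

module Defs where

open import Level using (Level; _⊔_; suc)
open import Data.Bool using (Bool; true; false; T; if_then_else_)
open import Data.Nat using (ℕ)
open import Data.Fin using (Fin; _≟_)
open import Data.List using (List; []; _∷_; _++_; map; concatMap; replicate; length; filter)
open import Data.List.Base using (sum)
open import Data.Fin.Base using ()
open import Data.List.Base using ()
open import Data.Product using (Σ; _×_; _,_; ∃; ∃-syntax)
open import Relation.Nullary using (¬_; yes; no)
open import Relation.Binary.PropositionalEquality using (_≡_)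
open import Algebra.Bundles using (Group; CommutativeRing)
open import Function.Bundles using (_⇔_)
import Data.Fin as Fin
import Data.List as List

record StarRing (a ℓ : Level) : Set (suc (a ⊔ ℓ)) where
  field
    commRing : CommutativeRing a ℓ
  open CommutativeRing commRing public
  field
    conj            : Carrier → Carrier
    conj-cong       : ∀ {x y} → x ≈ y → conj x ≈ conj y
    conj-involutive : ∀ x → conj (conj x) ≈ x
    conj-+          : ∀ x y → conj (x + y) ≈ conj x + conj y
    conj-*          : ∀ x y → conj (x * y) ≈ conj x * conj y
    conj-1          : conj 1# ≈ 1#
    nontrivial      : ¬ (1# ≈ 0#)

record SimpleGraph (n : ℕ) : Set where
  field
    adj       : Fin n → Fin n → Bool
    adj-sym   : ∀ i j → adj i j ≡ adj j i
    adj-irrefl : ∀ i → adj i i ≡ false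

module _ {n : ℕ} (Γ : SimpleGraph n) where
  open SimpleGraph Γ

  Adjacent : Fin n → Fin n → Set
  Adjacent i j = T (adj i j)

  data Reachable : Fin n → Fin n → Set where
    here : ∀ {i} → Reachable i i
    step : ∀ {i k j} → Adjacent i k → Reachable k j → Reachable i j

  Connected : Set
  Connected = ∀ i j → Reachable i j

  HasEdge : Set
  HasEdge = ∃[ i ] ∃[ j ] Adjacent i j

  degree : Fin n → ℕ
  degree i = length (filter (λ j → T? (adj i j)) (List.allFin n))
    where
    open import Data.Bool using () renaming (T? to T?)

module _ {g ℓg : Level} (G : Group g ℓg) {n : ℕ} (Γ : SimpleGraph n) where
  open Group G

  record GainFunction : Set (g ⊔ ℓg) where
    field
      ψ     : ∀ i j → Adjacent Γ i j → Carrier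
      ψ-inv : ∀ i j (p : Adjacent Γ i j) (q : Adjacent Γ j i) → ψ j i q ≈ (ψ i j p) ⁻¹

  SwitchingEquivalent : GainFunction → GainFunction → Set (g ⊔ ℓg)
  SwitchingEquivalent ψ₁ ψ₂ =
    Σ (Fin n → Carrier) λ f → (∀ i j (p : Adjacent Γ i j) →
      GainFunction.ψ ψ₂ i j p ≈ (f i) ⁻¹ ∙ GainFunction.ψ ψ₁ i j p ∙ f j)

-- The group algebra K G: finite formal sums Σ a_k x_k, represented by
-- lists of (coefficient, group element), modulo the congruence generated
-- by reordering, merging equal group elements, and dropping zero terms
-- (i.e. the free K-module on G).

module GroupAlgebra {a ℓa g ℓg : Level} (K : StarRing a ℓa) (G : Group g ℓg) where
  private
    module K = StarRing K
    module G = Group G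

  KG : Set (a ⊔ g)
  KG = List (K.Carrier × G.Carrier)

  infix 4 _≋_
  data _≋_ : KG → KG → Set (a ⊔ g ⊔ ℓa ⊔ ℓg) where
    ≋-refl  : ∀ {u} → u ≋ u
    ≋-sym   : ∀ {u v} → u ≋ v → v ≋ u
    ≋-trans : ∀ {u v w} → u ≋ v → v ≋ w → u ≋ w
    ≋-cons  : ∀ {c d x y u v} → c K.≈ d → x G.≈ y → u ≋ v → (c , x) ∷ u ≋ (d , y) ∷ v
    ≋-swap  : ∀ {p q u} → p ∷ q ∷ u ≋ q ∷ p ∷ u
    ≋-merge : ∀ {c d x y u} → x G.≈ y → (c , x) ∷ (d , y) ∷ u ≋ (c K.+ d , x) ∷ u
    ≋-zero  : ∀ {x u} → (K.0# , x) ∷ u ≋ u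

  0ᴳ : KG
  0ᴳ = []

  _⊕_ : KG → KG → KG
  _⊕_ = _++_

  _⊛_ : KG → KG → KG
  u ⊛ v = concatMap (λ { (c , x) → map (λ { (d , y) → (c K.* d , x G.∙ y) }) v }) u

  star : KG → KG
  star = map (λ { (c , x) → (K.conj c , x G.⁻¹) })

  ι : G.Carrier → KG
  ι x = (K.1# , x) ∷ []

  nat : ℕ → KG
  nat m = replicate m (K.1# , G.ε)

  Matrix : ℕ → Set (a ⊔ g)
  Matrix n = Fin n → Fin n → KG

  _≋ᴹ_ : ∀ {n} → Matrix n → Matrix n → Set (a ⊔ g ⊔ ℓa ⊔ ℓg)
  A ≋ᴹ B = ∀ i j → A i j ≋ B i j

  _·ᴹ_ : ∀ {n} → Matrix n → Matrix n → Matrix n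
  _·ᴹ_ {n} A B i j = List.foldr _⊕_ 0ᴳ (map (λ k → A i k ⊛ B k j) (List.allFin n))

  _*ᴹ : ∀ {n} → Matrix n → Matrix n
  (A *ᴹ) i j = star (A j i)

  _∼_ : ∀ {n} → Matrix n → Matrix n → Set (a ⊔ g ⊔ ℓa ⊔ ℓg)
  _∼_ {n} A B = ∃[ F ]
    ( (∀ i j → ¬ (i ≡ j) → F i j ≋ 0ᴳ)
    × (∀ i → ∃[ x ] (F i i ≋ ι x))
    × ((((F *ᴹ) ·ᴹ A) ·ᴹ F) ≋ᴹ B) )

  private
    entry : (b : Bool) → (T b → G.Carrier) → KG
    entry true  f = ι (f _)
    entry false f = 0ᴳ

  adjacency : ∀ {n} (Γ : SimpleGraph n) → GainFunction G Γ → Matrix n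
  adjacency Γ ψ i j = entry (SimpleGraph.adj Γ i j) (GainFunction.ψ ψ i j)

  laplacian : ∀ {n} (Γ : SimpleGraph n) → G.Carrier → GainFunction G Γ → Matrix n
  laplacian Γ s ψ i j with i ≟ j
  ... | yes _ = nat (degree Γ i) ⊕ (ι s ⊛ adjacency Γ ψ i j)
  ... | no  _ = 0ᴳ ⊕ (ι s ⊛ adjacency Γ ψ i j)

-- Conjugating by a diagonal matrix with entries x₁, …, xₙ ∈ G turns the (i, j) entry u into the
-- sandwich xᵢ⁻¹ u xⱼ, so A ∼ B says that the entries of B are those of A sandwiched by one family x.
-- Off the diagonal the entries of A_{Γ,ψ} and Δ^s_{Γ,ψ} are 0, ψ(vᵢ,vⱼ) or s ψ(vᵢ,vⱼ); since s is
-- central and the diagonal of Δ^s consists of multiples of 1_G, which every sandwich fixes, both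
-- conditions reduce to the switching relation once a monomial c g with c ≠ 0 is known to determine g.
-- Equality in G need not be decidable, so that is proved with an invariant of ≋: terms are labelled
-- by natural numbers naming classes of equal group elements, and every label keeps the coefficient
-- sum it has in c g; when two terms with distinct labels merge, one label is redirected to the other.

module Submission where

open import Defs
open import Level using (Level; _⊔_)
open import Data.Bool using (Bool; true; false; T; if_then_else_)
open import Data.Empty using (⊥-elim)
open import Data.Fin using (Fin; zero; suc)
import Data.Fin as Fin
import Data.Fin.Properties as Fin
open import Data.List using (List; []; _∷_; _++_; map; foldr; tabulate; allFin)
open import Data.List.Properties using (map-tabulate; ++-identityʳ; ++-assoc; map-++)
open import Data.List.Relation.Binary.Pointwise using (Pointwise; []; _∷_; ++⁺)
open import Data.List.Relation.Unary.All using (All; []; _∷_)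
import Data.List.Relation.Unary.All as All
open import Data.Nat using (ℕ; suc; _+_; _<_; z<s; _≟_)
open import Data.Nat.Properties using (<⇒≢; m≤m+n; m≤n+m; <-≤-trans)
open import Data.Product using (∃-syntax; _×_; _,_; proj₁; proj₂; swap)
import Data.Product.Function.Dependent.Propositional as Σ
open import Data.Unit using (tt)
open import Function using (_∘_; id)
open import Function.Bundles using (_⇔_; mk⇔; Equivalence)
open import Function.Construct.Composition using (_⇔-∘_)
open import Function.Construct.Symmetry using (⇔-sym)
open import Algebra.Bundles using (Group)
import Algebra.Properties.Group as GroupProperties
import Algebra.Properties.CommutativeSemigroup as CommutativeSemigroupProperties
open import Relation.Binary.PropositionalEquality
  using (_≡_; _≢_; refl; sym; trans; cong; cong₂; subst; module ≡-Reasoning)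
open import Relation.Nullary using (¬_; yes; no; contradiction)
open import Relation.Nullary.Decidable using (isYes)

∀-⇔ : ∀ {i p q} {I : Set i} {P : I → Set p} {Q : I → Set q} →
      (∀ x → P x ⇔ Q x) → (∀ x → P x) ⇔ (∀ x → Q x)
∀-⇔ P⇔Q = mk⇔ (λ P x → Equivalence.to (P⇔Q x) (P x)) (λ Q x → Equivalence.from (P⇔Q x) (Q x))

module Congruence {a ℓa g ℓg : Level} (K : StarRing a ℓa) (G : Group g ℓg) where
  private
    module K = StarRing K
    module G = Group G
  open GroupAlgebra K G

  ≡⇒≋ : ∀ {u v} → u ≡ v → u ≋ v
  ≡⇒≋ refl = ≋-refl

  ≋-∷ : ∀ p {u v} → u ≋ v → p ∷ u ≋ p ∷ v
  ≋-∷ p = ≋-cons K.refl G.refl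

  ++-congˡ : ∀ {u u'} v → u ≋ u' → u ++ v ≋ u' ++ v
  ++-congˡ v ≋-refl        = ≋-refl
  ++-congˡ v (≋-sym e)     = ≋-sym (++-congˡ v e)
  ++-congˡ v (≋-trans e f) = ≋-trans (++-congˡ v e) (++-congˡ v f)
  ++-congˡ v (≋-cons c x e) = ≋-cons c x (++-congˡ v e)
  ++-congˡ v ≋-swap        = ≋-swap
  ++-congˡ v (≋-merge x)   = ≋-merge x
  ++-congˡ v ≋-zero        = ≋-zero

  ++-congʳ : ∀ u {v v'} → v ≋ v' → u ++ v ≋ u ++ v'
  ++-congʳ []      e = e
  ++-congʳ (p ∷ u) e = ≋-∷ p (++-congʳ u e)

  ++-cong : ∀ {u u' v v'} → u ≋ u' → v ≋ v' → u ++ v ≋ u' ++ v'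
  ++-cong {u' = u'} {v = v} e f = ≋-trans (++-congˡ v e) (++-congʳ u' f)

  ∷-++-comm : ∀ p u v → p ∷ (u ++ v) ≋ u ++ (p ∷ v)
  ∷-++-comm p []      v = ≋-refl
  ∷-++-comm p (q ∷ u) v = ≋-trans ≋-swap (≋-∷ q (∷-++-comm p u v))

  ++-swap : ∀ u v w → u ++ (v ++ w) ≋ v ++ (u ++ w)
  ++-swap []      v w = ≋-refl
  ++-swap (p ∷ u) v w = ≋-trans (≋-∷ p (++-swap u v w)) (∷-++-comm p v (u ++ w))

  -- (p ∷ u) ⊛ v reduces to scale p v ++ u ⊛ v
  scale : K.Carrier × G.Carrier → KG → KG
  scale (c , x) = map (λ q → (c K.* proj₁ q , x G.∙ proj₂ q))

  scale-congˡ : ∀ {c c' x x'} v → c K.≈ c' → x G.≈ x' → scale (c , x) v ≋ scale (c' , x') v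
  scale-congˡ []      e f = ≋-refl
  scale-congˡ (q ∷ v) e f = ≋-cons (K.*-cong e K.refl) (G.∙-cong f G.refl) (scale-congˡ v e f)

  scale-congʳ : ∀ p {v v'} → v ≋ v' → scale p v ≋ scale p v'
  scale-congʳ p ≋-refl         = ≋-refl
  scale-congʳ p (≋-sym e)      = ≋-sym (scale-congʳ p e)
  scale-congʳ p (≋-trans e f)  = ≋-trans (scale-congʳ p e) (scale-congʳ p f)
  scale-congʳ p (≋-cons e f h) = ≋-cons (K.*-cong K.refl e) (G.∙-cong G.refl f) (scale-congʳ p h)
  scale-congʳ p ≋-swap         = ≋-swap
  scale-congʳ (c , x) (≋-merge e) =
    ≋-trans (≋-merge (G.∙-cong G.refl e)) (≋-cons (K.sym (K.distribˡ c _ _)) G.refl ≋-refl)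
  scale-congʳ (c , x) ≋-zero = ≋-trans (≋-cons (K.zeroʳ c) G.refl ≋-refl) ≋-zero

  scale-+ : ∀ c d {x y} v w → x G.≈ y →
            scale (c , x) v ++ (scale (d , y) v ++ w) ≋ scale (c K.+ d , x) v ++ w
  scale-+ c d []      w e = ≋-refl
  scale-+ c d {x} {y} (q ∷ v) w e =
    ≋-trans (≋-∷ _ (≋-sym (∷-++-comm _ (scale (c , x) v) (scale (d , y) v ++ w))))
      (≋-trans (≋-merge (G.∙-cong e G.refl))
        (≋-cons (K.sym (K.distribʳ (proj₁ q) c d)) G.refl (scale-+ c d v w e)))

  scale-0 : ∀ x v w → scale (K.0# , x) v ++ w ≋ w
  scale-0 x []      w = ≋-refl
  scale-0 x (q ∷ v) w = ≋-trans (≋-cons (K.zeroˡ _) G.refl ≋-refl) (≋-trans ≋-zero (scale-0 x v w))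

  ⊛-congˡ : ∀ {u u'} v → u ≋ u' → u ⊛ v ≋ u' ⊛ v
  ⊛-congˡ v ≋-refl         = ≋-refl
  ⊛-congˡ v (≋-sym e)      = ≋-sym (⊛-congˡ v e)
  ⊛-congˡ v (≋-trans e f)  = ≋-trans (⊛-congˡ v e) (⊛-congˡ v f)
  ⊛-congˡ v (≋-cons e f h) = ++-cong (scale-congˡ v e f) (⊛-congˡ v h)
  ⊛-congˡ v (≋-swap {p} {q} {u})            = ++-swap (scale p v) (scale q v) (u ⊛ v)
  ⊛-congˡ v (≋-merge {c} {d} {x} {y} {u} e) = scale-+ c d v (u ⊛ v) e
  ⊛-congˡ v (≋-zero {x} {u})                = scale-0 x v (u ⊛ v)

  ⊛-congʳ : ∀ u {v v'} → v ≋ v' → u ⊛ v ≋ u ⊛ v'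
  ⊛-congʳ []      e = ≋-refl
  ⊛-congʳ (p ∷ u) e = ++-cong (scale-congʳ p e) (⊛-congʳ u e)

  ⊛-cong : ∀ {u u' v v'} → u ≋ u' → v ≋ v' → u ⊛ v ≋ u' ⊛ v'
  ⊛-cong {u' = u'} {v = v} e f = ≋-trans (⊛-congˡ v e) (⊛-congʳ u' f)

  conj-0 : K.conj K.0# K.≈ K.0#
  conj-0 = begin
    K.conj K.0#                          ≈⟨ K.conj-cong (K.sym (K.zeroˡ (K.conj K.0#))) ⟩
    K.conj (K.0# K.* K.conj K.0#)        ≈⟨ K.conj-* _ _ ⟩
    K.conj K.0# K.* K.conj (K.conj K.0#) ≈⟨ K.*-cong K.refl (K.conj-involutive _) ⟩
    K.conj K.0# K.* K.0#                 ≈⟨ K.zeroʳ _ ⟩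
    K.0#                                 ∎
    where open import Relation.Binary.Reasoning.Setoid K.setoid

  star-cong : ∀ {u v} → u ≋ v → star u ≋ star v
  star-cong ≋-refl         = ≋-refl
  star-cong (≋-sym e)      = ≋-sym (star-cong e)
  star-cong (≋-trans e f)  = ≋-trans (star-cong e) (star-cong f)
  star-cong (≋-cons e f h) = ≋-cons (K.conj-cong e) (G.⁻¹-cong f) (star-cong h)
  star-cong ≋-swap         = ≋-swap
  star-cong (≋-merge e)    =
    ≋-trans (≋-merge (G.⁻¹-cong e)) (≋-cons (K.sym (K.conj-+ _ _)) G.refl ≋-refl)
  star-cong ≋-zero         = ≋-trans (≋-cons conj-0 G.refl ≋-refl) ≋-zero

  ·ᴹ-cong : ∀ {n} {A A' B B' : Matrix n} → A ≋ᴹ A' → B ≋ᴹ B' → (A ·ᴹ B) ≋ᴹ (A' ·ᴹ B')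
  ·ᴹ-cong {n} {A} {A'} {B} {B'} e f i j = sum-cong (allFin n)
    where
    sum-cong : ∀ ks → foldr _⊕_ 0ᴳ (map (λ k → A i k ⊛ B k j) ks)
                    ≋ foldr _⊕_ 0ᴳ (map (λ k → A' i k ⊛ B' k j) ks)
    sum-cong []       = ≋-refl
    sum-cong (k ∷ ks) = ++-cong (⊛-cong (e i k) (f k j)) (sum-cong ks)

  *ᴹ-cong : ∀ {n} {A A' : Matrix n} → A ≋ᴹ A' → (A *ᴹ) ≋ᴹ (A' *ᴹ)
  *ᴹ-cong e i j = star-cong (e j i)

module MonomialInjectivity {a ℓa g ℓg : Level} (K : StarRing a ℓa) (G : Group g ℓg) where
  private
    module K = StarRing K
    module G = Group G
  open GroupAlgebra K G
  open CommutativeSemigroupProperties K.+-commutativeSemigroup using (interchange)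
  open import Relation.Binary.Reasoning.Setoid K.setoid

  δ : ℕ → ℕ → K.Carrier → K.Carrier
  δ l k c = if isYes (l ≟ k) then c else K.0#

  δ-diag : ∀ k c → δ k k c ≡ c
  δ-diag k c with k ≟ k
  ... | yes _   = refl
  ... | no k≢k  = contradiction refl k≢k

  δ-off : ∀ {l k} c → l ≢ k → δ l k c ≡ K.0#
  δ-off {l} {k} c l≢k with l ≟ k
  ... | yes l≡k = contradiction l≡k l≢k
  ... | no _    = refl

  δ-cong : ∀ l k {c d} → c K.≈ d → δ l k c K.≈ δ l k d
  δ-cong l k e with l ≟ k
  ... | yes _ = e
  ... | no _  = K.refl

  δ-+ : ∀ l k c d → δ l k (c K.+ d) K.≈ δ l k c K.+ δ l k d
  δ-+ l k c d with l ≟ k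
  ... | yes _ = K.refl
  ... | no _  = K.sym (K.+-identityˡ K.0#)

  δ-0 : ∀ l k → δ l k K.0# K.≈ K.0#
  δ-0 l k with l ≟ k
  ... | yes _ = K.refl
  ... | no _  = K.refl

  Labelled : (ℕ → G.Carrier) → KG → List ℕ → Set (a ⊔ g ⊔ ℓg)
  Labelled W = Pointwise (λ p l → proj₂ p G.≈ W l)

  coeff : KG → List ℕ → ℕ → K.Carrier
  coeff []      _        k = K.0#
  coeff (p ∷ u) []       k = K.0#
  coeff (p ∷ u) (l ∷ ls) k = δ l k (proj₁ p) K.+ coeff u ls k

  coeff-++ : ∀ {W u ls} → Labelled W u ls → ∀ v ls' k →
             coeff (u ++ v) (ls ++ ls') k K.≈ coeff u ls k K.+ coeff v ls' k
  coeff-++ []        v ls' k = K.sym (K.+-identityˡ _)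
  coeff-++ (_ ∷ lab) v ls' k = K.trans (K.+-cong K.refl (coeff-++ lab v ls' k)) (K.sym (K.+-assoc _ _ _))

  data Split (W : ℕ → G.Carrier) (u v : KG) : List ℕ → Set (a ⊔ g ⊔ ℓg) where
    split-at : ∀ {ls ls'} → Labelled W u ls → Labelled W v ls' → Split W u v (ls ++ ls')

  split : ∀ {W} u {v ls} → Labelled W (u ++ v) ls → Split W u v ls
  split []      lab = split-at [] lab
  split (p ∷ u) (e ∷ lab) with split u lab
  ... | split-at lab₁ lab₂ = split-at (e ∷ lab₁) lab₂

  _⇝_ : KG → KG → Set (a ⊔ g ⊔ ℓa ⊔ ℓg)
  X ⇝ Y = ∀ {W lx} → Labelled W X lx →
          ∃[ ly ] Labelled W Y ly × (∀ k → coeff Y ly k K.≈ coeff X lx k)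

  ⇝-replace : ∀ {c d x y} → c K.≈ d → x G.≈ y → ((c , x) ∷ []) ⇝ ((d , y) ∷ [])
  ⇝-replace c≈d x≈y {lx = l ∷ []} (x≈Wl ∷ []) =
    l ∷ [] , G.trans (G.sym x≈y) x≈Wl ∷ [] , λ k → K.+-cong (δ-cong l k (K.sym c≈d)) K.refl

  ⇝-swap : ∀ {p q} → (p ∷ q ∷ []) ⇝ (q ∷ p ∷ [])
  ⇝-swap {p} {q} {lx = l ∷ l' ∷ []} (e ∷ e' ∷ []) = l' ∷ l ∷ [] , e' ∷ e ∷ [] , λ k →
    K.trans (K.sym (K.+-assoc _ _ _)) (K.trans (K.+-cong (K.+-comm _ _) K.refl) (K.+-assoc _ _ _))

  ⇝-split : ∀ {c d x y} → x G.≈ y → ((c K.+ d , x) ∷ []) ⇝ ((c , x) ∷ (d , y) ∷ [])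
  ⇝-split {c} {d} x≈y {lx = l ∷ []} (x≈Wl ∷ []) =
    l ∷ l ∷ [] , x≈Wl ∷ G.trans (G.sym x≈y) x≈Wl ∷ [] , λ k →
      K.trans (K.sym (K.+-assoc _ _ _)) (K.+-cong (K.sym (δ-+ l k c d)) K.refl)

  ⇝-zero : ∀ {x} → ((K.0# , x) ∷ []) ⇝ []
  ⇝-zero {lx = l ∷ []} (_ ∷ []) = [] , [] , λ k → K.sym (K.trans (K.+-identityʳ _) (δ-0 l k))

  _[_≔_] : (ℕ → G.Carrier) → ℕ → G.Carrier → ℕ → G.Carrier
  (W [ f ≔ x ]) l = if isYes (l ≟ f) then x else W l

  ≔-at : ∀ W f x → (W [ f ≔ x ]) f ≡ x
  ≔-at W f x with f ≟ f
  ... | yes _   = refl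
  ... | no f≢f  = contradiction refl f≢f

  ≔-other : ∀ W {f l} x → l ≢ f → (W [ f ≔ x ]) l ≡ W l
  ≔-other W {f} {l} x l≢f with l ≟ f
  ... | yes l≡f = contradiction l≡f l≢f
  ... | no _    = refl

  Labelled-≔ : ∀ W {f u ls} x → All (_< f) ls → Labelled W u ls → Labelled (W [ f ≔ x ]) u ls
  Labelled-≔ W x [] [] = []
  Labelled-≔ W x (l<f ∷ ls<f) (e ∷ lab) =
    G.trans e (G.reflexive (sym (≔-other W x (<⇒≢ l<f)))) ∷ Labelled-≔ W x ls<f lab

  fresh-label : (ls : List ℕ) → ∃[ f ] All (_< f) (0 ∷ ls)
  fresh-label []       = 1 , z<s ∷ []
  fresh-label (l ∷ ls) with fresh-label ls
  ... | f , 0<f ∷ ls<f = suc l + f , <-≤-trans 0<f (m≤n+m f (suc l)) ∷ m≤m+n (suc l) f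
                                   ∷ All.map (λ l'<f → <-≤-trans l'<f (m≤n+m f (suc l))) ls<f

  redirect : ℕ → ℕ → ℕ → ℕ
  redirect fr to l = if isYes (l ≟ fr) then to else l

  redirect-from : ∀ fr to → redirect fr to fr ≡ to
  redirect-from fr to with fr ≟ fr
  ... | yes _    = refl
  ... | no fr≢fr = contradiction refl fr≢fr

  redirect-to : ∀ fr to → redirect fr to to ≡ to
  redirect-to fr to with to ≟ fr
  ... | yes _ = refl
  ... | no _  = refl

  ≈-redirect : ∀ (W : ℕ → G.Carrier) {fr to l x} → W fr G.≈ W to →
               x G.≈ W l → x G.≈ W (redirect fr to l)
  ≈-redirect W {fr = fr} {l = l} Wfr≈Wto x≈Wl with l ≟ fr
  ... | yes refl = G.trans x≈Wl Wfr≈Wto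
  ... | no _     = x≈Wl

  Labelled-redirect : ∀ (W : ℕ → G.Carrier) {fr to u ls} → W fr G.≈ W to →
                      Labelled W u ls → Labelled W u (map (redirect fr to) ls)
  Labelled-redirect W Wfr≈Wto []        = []
  Labelled-redirect W Wfr≈Wto (e ∷ lab) = ≈-redirect W Wfr≈Wto e ∷ Labelled-redirect W Wfr≈Wto lab

  module _ {fr to : ℕ} (fr≢to : fr ≢ to) where

    δ-redirect-from : ∀ l c → δ (redirect fr to l) fr c ≡ K.0#
    δ-redirect-from l c with l ≟ fr
    ... | yes refl = δ-off c (fr≢to ∘ sym)
    ... | no l≢fr  = δ-off c l≢fr

    δ-redirect-to : ∀ l c → δ (redirect fr to l) to c K.≈ δ l to c K.+ δ l fr c
    δ-redirect-to l c with l ≟ fr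
    ... | yes refl = K.trans (K.reflexive (δ-diag to c)) (K.trans (K.sym (K.+-identityˡ c))
                       (K.+-cong (K.reflexive (sym (δ-off c fr≢to))) K.refl))
    ... | no _     = K.sym (K.+-identityʳ _)

    δ-redirect-other : ∀ {k} → k ≢ fr → k ≢ to → ∀ l c → δ (redirect fr to l) k c ≡ δ l k c
    δ-redirect-other k≢fr k≢to l c with l ≟ fr
    ... | yes refl = trans (δ-off c (k≢to ∘ sym)) (sym (δ-off c (k≢fr ∘ sym)))
    ... | no _     = refl

    coeff-redirect-from : ∀ u ls → coeff u (map (redirect fr to) ls) fr K.≈ K.0#
    coeff-redirect-from []      ls       = K.refl
    coeff-redirect-from (p ∷ u) []       = K.refl
    coeff-redirect-from (p ∷ u) (l ∷ ls) =
      K.trans (K.+-cong (K.reflexive (δ-redirect-from l (proj₁ p))) (coeff-redirect-from u ls))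
              (K.+-identityˡ _)

    coeff-redirect-to : ∀ u ls →
      coeff u (map (redirect fr to) ls) to K.≈ coeff u ls to K.+ coeff u ls fr
    coeff-redirect-to []      ls       = K.sym (K.+-identityˡ _)
    coeff-redirect-to (p ∷ u) []       = K.sym (K.+-identityˡ _)
    coeff-redirect-to (p ∷ u) (l ∷ ls) =
      K.trans (K.+-cong (δ-redirect-to l (proj₁ p)) (coeff-redirect-to u ls)) (interchange _ _ _ _)

    coeff-redirect-other : ∀ {k} → k ≢ fr → k ≢ to → ∀ u ls →
      coeff u (map (redirect fr to) ls) k K.≈ coeff u ls k
    coeff-redirect-other k≢fr k≢to []      ls       = K.refl
    coeff-redirect-other k≢fr k≢to (p ∷ u) []       = K.refl
    coeff-redirect-other k≢fr k≢to (p ∷ u) (l ∷ ls) =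
      K.+-cong (K.reflexive (δ-redirect-other k≢fr k≢to l (proj₁ p)))
               (coeff-redirect-other k≢fr k≢to u ls)

  module Concentration (c₀ : K.Carrier) (a₀ : G.Carrier) where

    -- u agrees with the monomial c₀ a₀ class by class, label 0 naming the class of a₀.
    ConcentratedBy : (ℕ → G.Carrier) → List ℕ → KG → Set (a ⊔ g ⊔ ℓa ⊔ ℓg)
    ConcentratedBy W ls u = Labelled W u ls × W 0 G.≈ a₀ × (∀ k → coeff u ls k K.≈ δ 0 k c₀)

    Concentrated : KG → Set (a ⊔ g ⊔ ℓa ⊔ ℓg)
    Concentrated u = ∃[ W ] ∃[ ls ] ConcentratedBy W ls u

    replace-segment : ∀ {W H X Y r lh lx ly lr} →
      Labelled W H lh → Labelled W X lx → Labelled W Y ly → Labelled W r lr →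
      (∀ k → coeff Y ly k K.≈ coeff X lx k) →
      ConcentratedBy W (lh ++ lx ++ lr) (H ++ X ++ r) → ConcentratedBy W (lh ++ ly ++ lr) (H ++ Y ++ r)
    replace-segment {H = H} {X} {Y} {r} {lh} {lx} {ly} {lr} lH lX lY lR Y≈X (_ , W0≈a₀ , concentrated) =
      ++⁺ lH (++⁺ lY lR) , W0≈a₀ , λ k → begin
        coeff (H ++ Y ++ r) (lh ++ ly ++ lr) k              ≈⟨ coeff-++ lH (Y ++ r) (ly ++ lr) k ⟩
        coeff H lh k K.+ coeff (Y ++ r) (ly ++ lr) k       ≈⟨ K.+-cong K.refl (coeff-++ lY r lr k) ⟩
        coeff H lh k K.+ (coeff Y ly k K.+ coeff r lr k)   ≈⟨ K.+-cong K.refl (K.+-cong (Y≈X k) K.refl) ⟩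
        coeff H lh k K.+ (coeff X lx k K.+ coeff r lr k)   ≈⟨ K.+-cong K.refl (coeff-++ lX r lr k) ⟨
        coeff H lh k K.+ coeff (X ++ r) (lx ++ lr) k       ≈⟨ coeff-++ lH (X ++ r) (lx ++ lr) k ⟨
        coeff (H ++ X ++ r) (lh ++ lx ++ lr) k              ≈⟨ concentrated k ⟩
        δ 0 k c₀                                            ∎

    Preserves : KG → KG → Set (a ⊔ g ⊔ ℓa ⊔ ℓg)
    Preserves u v = ∀ H → Concentrated (H ++ u) → Concentrated (H ++ v)

    ⇝-preserves : ∀ {X Y} → X ⇝ Y → ∀ r → Preserves (X ++ r) (Y ++ r)
    ⇝-preserves {X} X⇝Y r H (W , _ , concentrated@(lab , _)) with split H lab
    ... | split-at lH lXr with split X lXr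
    ... | split-at lX lR with X⇝Y lX
    ... | ly , lY , Y≈X = W , _ , replace-segment lH lX lY lR Y≈X concentrated

    ∷-preserves : ∀ p {u v} → Preserves u v → Preserves (p ∷ u) (p ∷ v)
    ∷-preserves p {u} {v} u⇒v H concentrated =
      subst Concentrated (++-assoc H (p ∷ []) v)
        (u⇒v (H ++ p ∷ []) (subst Concentrated (sym (++-assoc H (p ∷ []) u)) concentrated))

    zero-preserves : ∀ x u → Preserves u ((K.0# , x) ∷ u)
    zero-preserves x u H (W , ls , lab , W0≈a₀ , concentrated) with fresh-label ls
    ... | f , 0<f ∷ ls<f with split H (Labelled-≔ W x ls<f lab)
    ... | split-at lH lR =
      W [ f ≔ x ] , _ , replace-segment {X = []} lH [] lY lR new-coeff
                          (Labelled-≔ W x ls<f lab , W0≈a₀′ , concentrated)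
      where
      lY : Labelled (W [ f ≔ x ]) ((K.0# , x) ∷ []) (f ∷ [])
      lY = G.reflexive (sym (≔-at W f x)) ∷ []
      new-coeff : ∀ k → coeff ((K.0# , x) ∷ []) (f ∷ []) k K.≈ K.0#
      new-coeff k = K.trans (K.+-identityʳ _) (δ-0 f k)
      W0≈a₀′ : (W [ f ≔ x ]) 0 G.≈ a₀
      W0≈a₀′ = G.trans (G.reflexive (≔-other W x (<⇒≢ 0<f))) W0≈a₀

    ConcentratedBy-redirect : ∀ {W ls u fr to} → fr ≢ 0 → fr ≢ to → W fr G.≈ W to →
      ConcentratedBy W ls u → ConcentratedBy W (map (redirect fr to) ls) u
    ConcentratedBy-redirect {W} {ls} {u} {fr} {to} fr≢0 fr≢to Wfr≈Wto (lab , W0≈a₀ , concentrated) =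
      Labelled-redirect W Wfr≈Wto lab , W0≈a₀ , concentrated′
      where
      δ0-fr : δ 0 fr c₀ ≡ K.0#
      δ0-fr = δ-off c₀ (fr≢0 ∘ sym)
      concentrated′ : ∀ k → coeff u (map (redirect fr to) ls) k K.≈ δ 0 k c₀
      concentrated′ k with k ≟ fr
      ... | yes refl = K.trans (coeff-redirect-from fr≢to u ls) (K.reflexive (sym δ0-fr))
      ... | no k≢fr with k ≟ to
      ... | yes refl = K.trans (coeff-redirect-to fr≢to u ls)
                         (K.trans (K.+-cong (concentrated k) (K.trans (concentrated fr) (K.reflexive δ0-fr)))
                                  (K.+-identityʳ _))
      ... | no k≢to  = K.trans (coeff-redirect-other fr≢to k≢fr k≢to u ls) (concentrated k)

    merge-same-label : ∀ {W H r c d x y lh l₁ l₂ lr} → l₁ ≡ l₂ →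
      Labelled W H lh → x G.≈ W l₁ → y G.≈ W l₂ → Labelled W r lr →
      ConcentratedBy W (lh ++ l₁ ∷ l₂ ∷ lr) (H ++ (c , x) ∷ (d , y) ∷ r) →
      Concentrated (H ++ (c K.+ d , x) ∷ r)
    merge-same-label {W} {c = c} {d} {l₁ = l} refl lH x≈Wl y≈Wl lR concentrated =
      W , _ , replace-segment lH (x≈Wl ∷ y≈Wl ∷ []) (x≈Wl ∷ []) lR merged concentrated
      where
      merged : ∀ k → δ l k (c K.+ d) K.+ K.0# K.≈ δ l k c K.+ (δ l k d K.+ K.0#)
      merged k = K.trans (K.+-cong (δ-+ l k c d) K.refl) (K.+-assoc _ _ _)

    merge-redirect : ∀ {W H r c d x y lh l₁ l₂ lr} fr to → fr ≢ 0 → fr ≢ to → W fr G.≈ W to →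
      redirect fr to l₁ ≡ redirect fr to l₂ →
      Labelled W H lh → x G.≈ W l₁ → y G.≈ W l₂ → Labelled W r lr →
      ConcentratedBy W (lh ++ l₁ ∷ l₂ ∷ lr) (H ++ (c , x) ∷ (d , y) ∷ r) →
      Concentrated (H ++ (c K.+ d , x) ∷ r)
    merge-redirect {W} {H} {r} {c} {d} {x} {y} {lh} {l₁} {l₂} {lr} fr to fr≢0 fr≢to Wfr≈Wto same
      lH x≈Wl₁ y≈Wl₂ lR concentrated =
      merge-same-label same (Labelled-redirect W Wfr≈Wto lH) (≈-redirect W Wfr≈Wto x≈Wl₁)
        (≈-redirect W Wfr≈Wto y≈Wl₂) (Labelled-redirect W Wfr≈Wto lR)
        (subst (λ ls → ConcentratedBy W ls (H ++ (c , x) ∷ (d , y) ∷ r))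
               (map-++ (redirect fr to) lh (l₁ ∷ l₂ ∷ lr))
               (ConcentratedBy-redirect fr≢0 fr≢to Wfr≈Wto concentrated))

    -- Redirect one label to the other, never away from the label 0 of a₀.
    merge-distinct-labels : ∀ {W H r c d x y lh l₁ l₂ lr} → l₁ ≢ l₂ → W l₁ G.≈ W l₂ →
      Labelled W H lh → x G.≈ W l₁ → y G.≈ W l₂ → Labelled W r lr →
      ConcentratedBy W (lh ++ l₁ ∷ l₂ ∷ lr) (H ++ (c , x) ∷ (d , y) ∷ r) →
      Concentrated (H ++ (c K.+ d , x) ∷ r)
    merge-distinct-labels {l₁ = l₁} {l₂} l₁≢l₂ Wl₁≈Wl₂ with l₂ ≟ 0
    ... | yes refl = merge-redirect l₁ 0 l₁≢l₂ l₁≢l₂ Wl₁≈Wl₂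
                       (trans (redirect-from l₁ 0) (sym (redirect-to l₁ 0)))
    ... | no l₂≢0  = merge-redirect l₂ l₁ l₂≢0 (l₁≢l₂ ∘ sym) (G.sym Wl₁≈Wl₂)
                       (trans (redirect-to l₂ l₁) (sym (redirect-from l₂ l₁)))

    merge-preserves : ∀ {c d x y} u → x G.≈ y → Preserves ((c , x) ∷ (d , y) ∷ u) ((c K.+ d , x) ∷ u)
    merge-preserves u x≈y H (W , _ , concentrated@(lab , _)) with split H lab
    ... | split-at lH (_∷_ {y = l₁} x≈Wl₁ (_∷_ {y = l₂} y≈Wl₂ lR)) with l₁ ≟ l₂
    ... | yes l₁≡l₂ = merge-same-label l₁≡l₂ lH x≈Wl₁ y≈Wl₂ lR concentrated
    ... | no l₁≢l₂  = merge-distinct-labels l₁≢l₂ (G.trans (G.sym x≈Wl₁) (G.trans x≈y y≈Wl₂))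
                        lH x≈Wl₁ y≈Wl₂ lR concentrated

    ≋⇒preserves : ∀ {u v} → u ≋ v → Preserves u v × Preserves v u
    ≋⇒preserves ≋-refl        = (λ H → id) , (λ H → id)
    ≋⇒preserves (≋-sym e)     = swap (≋⇒preserves e)
    ≋⇒preserves (≋-trans e f) =
      (λ H → proj₁ (≋⇒preserves f) H ∘ proj₁ (≋⇒preserves e) H) ,
      (λ H → proj₂ (≋⇒preserves e) H ∘ proj₂ (≋⇒preserves f) H)
    ≋⇒preserves (≋-cons {c} {d} {x} {y} {u} {v} c≈d x≈y e) =
      (λ H → ⇝-preserves (⇝-replace c≈d x≈y) v H
             ∘ ∷-preserves (c , x) (proj₁ (≋⇒preserves e)) H) ,
      (λ H → ⇝-preserves (⇝-replace (K.sym c≈d) (G.sym x≈y)) u H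
             ∘ ∷-preserves (d , y) (proj₂ (≋⇒preserves e)) H)
    ≋⇒preserves (≋-swap {u = u}) = ⇝-preserves ⇝-swap u , ⇝-preserves ⇝-swap u
    ≋⇒preserves (≋-merge {u = u} x≈y) = merge-preserves u x≈y , ⇝-preserves (⇝-split x≈y) u
    ≋⇒preserves (≋-zero {x} {u}) = ⇝-preserves ⇝-zero u , zero-preserves x u

    monomial-concentrated : Concentrated ((c₀ , a₀) ∷ [])
    monomial-concentrated = (λ _ → a₀) , 0 ∷ [] , G.refl ∷ [] , G.refl , λ k → K.+-identityʳ _

    concentrated-monomial : ∀ {d b} → ¬ c₀ K.≈ K.0# → Concentrated ((d , b) ∷ []) → b G.≈ a₀
    concentrated-monomial {d} c₀≉0 (W , l ∷ [] , b≈Wl ∷ [] , W0≈a₀ , concentrated) with l ≟ 0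
    ... | yes refl = G.trans b≈Wl W0≈a₀
    ... | no l≢0   = contradiction c₀≈0 c₀≉0
      where
      c₀≈0 : c₀ K.≈ K.0#
      c₀≈0 = begin
        c₀                 ≡⟨ δ-diag 0 c₀ ⟨
        δ 0 0 c₀           ≈⟨ concentrated 0 ⟨
        δ l 0 d K.+ K.0#   ≈⟨ K.+-identityʳ _ ⟩
        δ l 0 d            ≡⟨ δ-off d l≢0 ⟩
        K.0#               ∎

  monomial-injective : ∀ {c a d b} → ¬ c K.≈ K.0# → (c , a) ∷ [] ≋ (d , b) ∷ [] → b G.≈ a
  monomial-injective {c} {a} c≉0 eq =
    concentrated-monomial c≉0 (proj₁ (≋⇒preserves eq) [] monomial-concentrated)
    where open Concentration c a

module DiagonalConjugation {a ℓa g ℓg : Level} (K : StarRing a ℓa) (G : Group g ℓg) where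
  private
    module K = StarRing K
    module G = Group G
  open GroupAlgebra K G
  open Congruence K G

  diagonal : ∀ {n} → (Fin n → G.Carrier) → Matrix n
  diagonal x i j = if isYes (i Fin.≟ j) then ι (x i) else 0ᴳ

  diagonal-off : ∀ {n} (x : Fin n → G.Carrier) {i j} → i ≢ j → diagonal x i j ≡ 0ᴳ
  diagonal-off x {i} {j} i≢j with i Fin.≟ j
  ... | yes i≡j = contradiction i≡j i≢j
  ... | no _    = refl

  diagonal-diag : ∀ {n} (x : Fin n → G.Carrier) i → diagonal x i i ≡ ι (x i)
  diagonal-diag x i with i Fin.≟ i
  ... | yes _   = refl
  ... | no i≢i  = contradiction refl i≢i

  ⊛-zeroʳ : ∀ u → u ⊛ 0ᴳ ≡ 0ᴳ
  ⊛-zeroʳ []      = refl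
  ⊛-zeroʳ (p ∷ u) = ⊛-zeroʳ u

  sum-tabulate-single : ∀ {n} (f : Fin n → KG) i → (∀ k → k ≢ i → f k ≡ 0ᴳ) →
                        foldr _⊕_ 0ᴳ (tabulate f) ≡ f i
  sum-tabulate-single f zero f≡0 =
    trans (cong (f zero ⊕_) (sum-zero (f ∘ suc) (λ k → f≡0 (suc k) λ ()))) (++-identityʳ (f zero))
    where
    sum-zero : ∀ {n} (f : Fin n → KG) → (∀ k → f k ≡ 0ᴳ) → foldr _⊕_ 0ᴳ (tabulate f) ≡ 0ᴳ
    sum-zero {ℕ.zero} f f≡0 = refl
    sum-zero {ℕ.suc n} f f≡0 rewrite f≡0 zero = sum-zero (f ∘ suc) (f≡0 ∘ suc)
  sum-tabulate-single f (suc i) f≡0 rewrite f≡0 zero (λ ()) =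
    sum-tabulate-single (f ∘ suc) i (λ k k≢i → f≡0 (suc k) (k≢i ∘ Fin.suc-injective))

  sum-single : ∀ {n} (f : Fin n → KG) i → (∀ k → k ≢ i → f k ≡ 0ᴳ) →
               foldr _⊕_ 0ᴳ (map f (allFin n)) ≡ f i
  sum-single f i f≡0 = trans (cong (foldr _⊕_ 0ᴳ) (map-tabulate id f)) (sum-tabulate-single f i f≡0)

  -- x⁻¹ u y, carrying the coefficient conj 1 that the involution puts on x⁻¹
  sandwich : G.Carrier → G.Carrier → KG → KG
  sandwich x y u = (((K.conj K.1# , x G.⁻¹) ∷ []) ⊛ u) ⊛ ι y

  diagonal-conjugate : ∀ {n} (x : Fin n → G.Carrier) (M : Matrix n) i j →
    (((diagonal x *ᴹ) ·ᴹ M) ·ᴹ diagonal x) i j ≡ sandwich (x i) (x j) (M i j)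
  diagonal-conjugate {n} x M i j = begin
    (((D *ᴹ) ·ᴹ M) ·ᴹ D) i j
      ≡⟨ sum-single _ j (λ k k≢j → trans (cong (((D *ᴹ) ·ᴹ M) i k ⊛_) (diagonal-off x k≢j))
                                         (⊛-zeroʳ (((D *ᴹ) ·ᴹ M) i k))) ⟩
    ((D *ᴹ) ·ᴹ M) i j ⊛ D j j
      ≡⟨ cong₂ _⊛_ (sum-single _ i (λ k k≢i → cong (λ z → star z ⊛ M k j) (diagonal-off x k≢i)))
                   (diagonal-diag x j) ⟩
    (star (D i i) ⊛ M i j) ⊛ ι (x j)
      ≡⟨ cong (λ z → (star z ⊛ M i j) ⊛ ι (x j)) (diagonal-diag x i) ⟩
    sandwich (x i) (x j) (M i j) ∎
    where
    open ≡-Reasoning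
    D : Matrix n
    D = diagonal x

  Sandwiches : ∀ {n} → (Fin n → G.Carrier) → Matrix n → Matrix n → Set (a ⊔ g ⊔ ℓa ⊔ ℓg)
  Sandwiches x M N = ∀ i j → sandwich (x i) (x j) (M i j) ≋ N i j

  ∼⇔sandwiches : ∀ {n} {M N : Matrix n} → M ∼ N ⇔ (∃[ x ] Sandwiches x M N)
  ∼⇔sandwiches {n} {M} {N} = mk⇔ from-∼ to-∼
    where
    from-∼ : M ∼ N → ∃[ x ] Sandwiches x M N
    from-∼ (F , F-off , F-diag , F*MF≋N) = x , λ i j →
      ≋-trans (≡⇒≋ (sym (diagonal-conjugate x M i j)))
        (≋-trans (·ᴹ-cong (·ᴹ-cong (*ᴹ-cong D≋F) (λ _ _ → ≋-refl)) D≋F i j) (F*MF≋N i j))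
      where
      x : Fin n → G.Carrier
      x i = proj₁ (F-diag i)
      D≋F : diagonal x ≋ᴹ F
      D≋F i j with i Fin.≟ j
      ... | yes refl = ≋-sym (proj₂ (F-diag i))
      ... | no i≢j   = ≋-sym (F-off i j i≢j)
    to-∼ : ∃[ x ] Sandwiches x M N → M ∼ N
    to-∼ (x , sandwiches) =
      diagonal x , (λ i j i≢j → ≡⇒≋ (diagonal-off x i≢j)) , (λ i → x i , ≡⇒≋ (diagonal-diag x i)) ,
      λ i j → ≋-trans (≡⇒≋ (diagonal-conjugate x M i j)) (sandwiches i j)

module GainGraphs {a ℓa g ℓg : Level} (K : StarRing a ℓa) (G : Group g ℓg) where
  private
    module K = StarRing K
    module G = Group G
  open GroupAlgebra K G
  open Congruence K G
  open MonomialInjectivity K G using (monomial-injective)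
  open DiagonalConjugation K G
  open GroupProperties G using (∙-cancelˡ)

  monomialIf : (b : Bool) → K.Carrier → (T b → G.Carrier) → KG
  monomialIf true  c φ = (c , φ tt) ∷ []
  monomialIf false c φ = []

  conj1-*-1 : ∀ c → (K.conj K.1# K.* c) K.* K.1# K.≈ c
  conj1-*-1 c = K.trans (K.*-identityʳ _) (K.trans (K.*-cong K.conj-1 K.refl) (K.*-identityˡ c))

  sandwich-monomialIf : ∀ x y b {c} (φ₁ φ₂ : T b → G.Carrier) → ¬ c K.≈ K.0# →
    (∀ p → φ₂ p G.≈ x G.⁻¹ G.∙ φ₁ p G.∙ y) ⇔ sandwich x y (monomialIf b c φ₁) ≋ monomialIf b c φ₂
  sandwich-monomialIf x y true {c} φ₁ φ₂ c≉0 = mk⇔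
    (λ φ₂≈ → ≋-cons (conj1-*-1 c) (G.sym (φ₂≈ tt)) ≋-refl)
    (λ sandwich≋ _ → monomial-injective (c≉0 ∘ K.trans (K.sym (conj1-*-1 c))) sandwich≋)
  sandwich-monomialIf x y false φ₁ φ₂ c≉0 = mk⇔ (λ _ → ≋-refl) (λ _ ())

  ι⊛monomialIf : ∀ s b (φ : T b → G.Carrier) →
    ι s ⊛ monomialIf b K.1# φ ≡ monomialIf b (K.1# K.* K.1#) (λ p → s G.∙ φ p)
  ι⊛monomialIf s true  φ = refl
  ι⊛monomialIf s false φ = refl

  sandwich-nat : ∀ x d → sandwich x x (nat d) ≋ nat d
  sandwich-nat x ℕ.zero    = ≋-refl
  sandwich-nat x (ℕ.suc d) =
    ≋-cons (conj1-*-1 K.1#) (G.trans (G.∙-cong (G.identityʳ _) G.refl) (G.inverseˡ x)) (sandwich-nat x d)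

  central-sandwich : ∀ {s} → (∀ z → s G.∙ z G.≈ z G.∙ s) → ∀ x y g h →
    (s G.∙ h G.≈ x G.⁻¹ G.∙ (s G.∙ g) G.∙ y) ⇔ (h G.≈ x G.⁻¹ G.∙ g G.∙ y)
  central-sandwich {s} central x y g h =
    mk⇔ (λ e → ∙-cancelˡ s _ _ (G.trans e s-out)) (λ e → G.trans (G.∙-cong G.refl e) (G.sym s-out))
    where
    open import Relation.Binary.Reasoning.Setoid G.setoid
    s-out : x G.⁻¹ G.∙ (s G.∙ g) G.∙ y G.≈ s G.∙ (x G.⁻¹ G.∙ g G.∙ y)
    s-out = begin
      x G.⁻¹ G.∙ (s G.∙ g) G.∙ y   ≈⟨ G.∙-cong (G.assoc _ _ _) G.refl ⟨
      x G.⁻¹ G.∙ s G.∙ g G.∙ y     ≈⟨ G.∙-cong (G.∙-cong (central _) G.refl) G.refl ⟨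
      s G.∙ x G.⁻¹ G.∙ g G.∙ y     ≈⟨ G.∙-cong (G.assoc _ _ _) G.refl ⟩
      s G.∙ (x G.⁻¹ G.∙ g) G.∙ y   ≈⟨ G.assoc _ _ _ ⟩
      s G.∙ (x G.⁻¹ G.∙ g G.∙ y)   ∎

  module _ {n : ℕ} (Γ : SimpleGraph n) where
    open SimpleGraph Γ

    adjacency-entry : ∀ ψ i j → adjacency Γ ψ i j ≡ monomialIf (adj i j) K.1# (GainFunction.ψ ψ i j)
    adjacency-entry ψ i j with adj i j | GainFunction.ψ ψ i j
    ... | true  | _ = refl
    ... | false | _ = refl

    adjacency-diag : ∀ ψ i → adjacency Γ ψ i i ≡ 0ᴳ
    adjacency-diag ψ i = trans (adjacency-entry ψ i i) (monomialIf-false (adj-irrefl i))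
      where
      monomialIf-false : ∀ {b φ} → b ≡ false → monomialIf b K.1# φ ≡ 0ᴳ
      monomialIf-false refl = refl

    module _ (ψ₁ ψ₂ : GainFunction G Γ) where
      private
        module ψ₁ = GainFunction ψ₁
        module ψ₂ = GainFunction ψ₂

      Switches : (Fin n → G.Carrier) → Set ℓg
      Switches x = ∀ i j (p : Adjacent Γ i j) → ψ₂.ψ i j p G.≈ x i G.⁻¹ G.∙ ψ₁.ψ i j p G.∙ x j

      switches⇔sandwiches-adjacency : ∀ x →
        Switches x ⇔ Sandwiches x (adjacency Γ ψ₁) (adjacency Γ ψ₂)
      switches⇔sandwiches-adjacency x = ∀-⇔ λ i → ∀-⇔ (entry i)
        where
        entry : ∀ i j → _ ⇔ sandwich (x i) (x j) (adjacency Γ ψ₁ i j) ≋ adjacency Γ ψ₂ i j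
        entry i j rewrite adjacency-entry ψ₁ i j | adjacency-entry ψ₂ i j =
          sandwich-monomialIf (x i) (x j) (adj i j) (ψ₁.ψ i j) (ψ₂.ψ i j) K.nontrivial

      laplacian-entry : ∀ s → (∀ z → s G.∙ z G.≈ z G.∙ s) → ∀ (x : Fin n → G.Carrier) i j →
        (∀ (p : Adjacent Γ i j) → ψ₂.ψ i j p G.≈ x i G.⁻¹ G.∙ ψ₁.ψ i j p G.∙ x j) ⇔
        sandwich (x i) (x j) (laplacian Γ s ψ₁ i j) ≋ laplacian Γ s ψ₂ i j
      laplacian-entry s central x i j with i Fin.≟ j
      ... | yes refl
        rewrite adjacency-diag ψ₁ i | adjacency-diag ψ₂ i | ++-identityʳ (nat (degree Γ i)) =
        mk⇔ (λ _ → sandwich-nat (x i) (degree Γ i)) (λ _ p → ⊥-elim (subst T (adj-irrefl i) p))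
      ... | no _
        rewrite adjacency-entry ψ₁ i j | adjacency-entry ψ₂ i j
              | ι⊛monomialIf s (adj i j) (ψ₁.ψ i j) | ι⊛monomialIf s (adj i j) (ψ₂.ψ i j) =
        sandwich-monomialIf (x i) (x j) (adj i j) _ _ (K.nontrivial ∘ K.trans (K.sym (K.*-identityˡ K.1#)))
          ⇔-∘ ∀-⇔ λ p → ⇔-sym (central-sandwich central (x i) (x j) (ψ₁.ψ i j p) (ψ₂.ψ i j p))

      switches⇔sandwiches-laplacian : ∀ s → (∀ z → s G.∙ z G.≈ z G.∙ s) → ∀ x →
        Switches x ⇔ Sandwiches x (laplacian Γ s ψ₁) (laplacian Γ s ψ₂)
      switches⇔sandwiches-laplacian s central x = ∀-⇔ λ i → ∀-⇔ (laplacian-entry s central x i)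

theorem3p5 : ∀ {a ℓa g ℓg : Level} (K : StarRing a ℓa) (G : Group g ℓg)
    {n : ℕ} (Γ : SimpleGraph n) → Connected Γ → HasEdge Γ →
    (s : Group.Carrier G) →
    (∀ x → Group._≈_ G (Group._∙_ G s x) (Group._∙_ G x s)) →
    Group._≈_ G (Group._∙_ G s s) (Group.ε G) →
    (ψ₁ ψ₂ : GainFunction G Γ) →
    (SwitchingEquivalent G Γ ψ₁ ψ₂
    ⇔ GroupAlgebra._∼_ K G (GroupAlgebra.adjacency K G Γ ψ₁) (GroupAlgebra.adjacency K G Γ ψ₂))
    × (GroupAlgebra._∼_ K G (GroupAlgebra.adjacency K G Γ ψ₁) (GroupAlgebra.adjacency K G Γ ψ₂)
    ⇔ GroupAlgebra._∼_ K G (GroupAlgebra.laplacian K G Γ s ψ₁) (GroupAlgebra.laplacian K G Γ s ψ₂))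
theorem3p5 K G Γ _ _ s central _ ψ₁ ψ₂ =
  switching⇔adjacency , switching⇔laplacian ⇔-∘ ⇔-sym switching⇔adjacency
  where
  open DiagonalConjugation K G using (∼⇔sandwiches)
  open GroupAlgebra K G using (_∼_; adjacency; laplacian)
  open GainGraphs K G
  switching⇔adjacency : SwitchingEquivalent G Γ ψ₁ ψ₂ ⇔ adjacency Γ ψ₁ ∼ adjacency Γ ψ₂
  switching⇔adjacency =
    ⇔-sym ∼⇔sandwiches ⇔-∘ Σ.congˡ (switches⇔sandwiches-adjacency Γ ψ₁ ψ₂ _)
  switching⇔laplacian : SwitchingEquivalent G Γ ψ₁ ψ₂ ⇔ laplacian Γ s ψ₁ ∼ laplacian Γ s ψ₂
  switching⇔laplacian =
    ⇔-sym ∼⇔sandwiches ⇔-∘ Σ.congˡ (switches⇔sandwiches-laplacian Γ ψ₁ ψ₂ s central _)
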